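{- Let $d\ge1$ and let $k>3$ be an odd integer. Suppose $S_1,\dots,S_k$ are $k$ distinct even-size subsets of $\{1,\dots,d\}$ such that $|S_\alpha\triangle S_\beta|\ge4$ for all $\alpha\ne\beta$, and such that for every four distinct indices $\alpha,\beta,\gamma,\delta$ the tetrahedral intersection number $$t_{\alpha\beta\gamma\delta}=\dim\big(M_\alpha\cap M_\beta\cap M_\gamma\cap M_\delta\big)=\#\{i\in\{1,\dots,d\}: i\in S_\alpha\cap S_\beta\cap S_\gamma\cap S_\delta\ \text{or}\ i\notin S_\alpha\cup S_\beta\cup S_\gamma\cup S_\delta\}$$ satisfies $t_{\alpha\beta\gamma\delta}\le d-7$. Then $$k^2(28-3d)-56k+15d\ \le\ 0 .$$ In particular, for $d=7$ one must have $k\le5$, and for $d=8$ one must have $k\le 11$.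
   Context: Setting: $\mathbb{C}^{2d}$ with a nondegenerate symmetric bilinear form and a canonical null basis $a_1,\dots,a_d,a_1^\dagger,\dots,a_d^\dagger$ ($g(a_i,a_j)=g(a_i^\dagger,a_j^\dagger)=0$, $g(a_i,a_j^\dagger)=\delta_{ij}$). For an even-size subset $S\subseteq\{1,\dots,d\}$, the basis pure semi-spinor $\psi_S=\prod_{i\in S}a_i^\dagger\psi_0$ (where $\psi_0$ is annihilated by all $a_i$) has null subspace $M_S=M(\psi_S)=\mathrm{Span}(\{a_i:i\notin S\}\cup\{a_i^\dagger:i\in S\})$; here $M_\alpha$ denotes $M(\psi_{S_\alpha})$. Pairwise, $\dim(M_S\cap M_T)=d-|S\triangle T|$. -}

module Defs where

open import Data.Nat using (ℕ)
open import Data.Fin using (Fin)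
open import Data.Fin.Subset using (Subset; _∪_; _∩_; _─_; ∁; ∣_∣)

_△_ : {d : ℕ} → Subset d → Subset d → Subset d
S △ T = (S ─ T) ∪ (T ─ S)

tet : {d : ℕ} → Subset d → Subset d → Subset d → Subset d → ℕ
tet A B C D = ∣ (A ∩ B ∩ C ∩ D) ∪ ∁ (A ∪ B ∪ C ∪ D) ∣

{-# OPTIONS --safe #-}
-- If more than 3·2^j indices are given, splitting them j times according to the
-- value of the next coordinate (pigeonhole) leaves four distinct indices whose
-- subsets agree on the first j coordinates, so their tetrahedral number is at
-- least j. Hence t ≤ d − 7 forces d ≥ 7 and k ≤ 3·2^(d−6). For d ≥ 10 the
-- polynomial is negative for every k ≥ 4 (all coefficients of its expansion at
-- d = 10 + e, k = 4 + a are negative), and for d = 7, 8, 9 only the finitely many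
-- odd k ≤ 6, 12, 24 remain, which are checked by evaluation.
module Submission where

open import Defs
open import Data.Bool using (Bool; true; false)
import Data.Bool as Bool
open import Data.Fin using (Fin)
open import Data.Fin.Subset using (Subset; ∣_∣)
open import Data.Integer using (ℤ; +_) renaming (_*_ to _*ℤ_; _+_ to _+ℤ_; _-_ to _-ℤ_; _≤_ to _≤ℤ_; -_ to -ℤ_)
import Data.Integer as ℤ
import Data.Integer.Properties as ℤ
open import Data.Integer.Tactic.RingSolver using () renaming (solve-∀ to ℤ-solve-∀)
open import Data.List using (List; []; _∷_; length; filter; allFin)
open import Data.List.Properties using (length-tabulate)
open import Data.List.Membership.Propositional using (_∈_)
open import Data.List.Membership.Propositional.Properties using (∈-filter⁻)
open import Data.List.Relation.Unary.All using (_∷_)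
open import Data.List.Relation.Unary.AllPairs using (_∷_)
open import Data.List.Relation.Unary.Any using (here; there)
open import Data.List.Relation.Unary.Unique.Propositional using (Unique)
open import Data.List.Relation.Unary.Unique.Propositional.Properties using (filter⁺; allFin⁺)
open import Data.Nat using (ℕ; zero; suc; _≤_; _<_; _+_; _*_; _^_; _∸_; z≤n; s≤s; _≟_; _≤?_; _<?_)
open import Data.Nat.Divisibility using (_∣_; _∣?_)
open import Data.Nat.Properties
  using (≤-trans; <⇒≤; +-mono-≤; +-monoˡ-≤; ≤⇒≯; ≮⇒≥; <-irrefl; m∸n≤m; m∸n+n≡m; +-suc; m≤n⇒∃[o]m+o≡n; allUpTo?)
open import Data.Nat.Tactic.RingSolver using (solve-∀)
open import Data.Product using (_×_; _,_)
open import Data.Sum using (_⊎_; inj₁; inj₂)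
open import Data.Vec using (_∷_; head; tail)
open import Relation.Nullary using (¬_; Dec; yes; no; contradiction; ¬?)
open import Relation.Nullary.Decidable using (from-yes; _×-dec_; _→-dec_)
open import Relation.Binary.PropositionalEquality
  using (_≡_; _≢_; refl; sym; trans; cong; cong₂; subst; subst₂; module ≡-Reasoning)

module _ {a} {A : Set a} (f : A → Bool) where

  fibre : Bool → List A → List A
  fibre b = filter (λ x → f x Bool.≟ b)

  ∈-fibre⁻ : ∀ {b x xs} → x ∈ fibre b xs → x ∈ xs × f x ≡ b
  ∈-fibre⁻ {b} = ∈-filter⁻ (λ x → f x Bool.≟ b)

  length-fibres : ∀ xs → length (fibre true xs) + length (fibre false xs) ≡ length xs
  length-fibres []       = refl
  length-fibres (x ∷ xs) with f x
  ... | true  = cong suc (length-fibres xs)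
  ... | false = trans (+-suc _ _) (cong suc (length-fibres xs))

m+m<n+o⇒m<n⊎m<o : ∀ m n o → m + m < n + o → m < n ⊎ m < o
m+m<n+o⇒m<n⊎m<o m n o m+m<n+o with m <? n | m <? o
... | yes m<n | _       = inj₁ m<n
... | no _    | yes m<o = inj₂ m<o
... | no m≮n  | no m≮o  = contradiction m+m<n+o (≤⇒≯ (+-mono-≤ (≮⇒≥ m≮n) (≮⇒≥ m≮o)))

tet-common-head : ∀ {d} x (A B C D : Subset (suc d)) →
  head A ≡ x → head B ≡ x → head C ≡ x → head D ≡ x →
  tet A B C D ≡ suc (tet (tail A) (tail B) (tail C) (tail D))
tet-common-head true  (true ∷ _)  (true ∷ _)  (true ∷ _)  (true ∷ _)  refl refl refl refl = refl
tet-common-head false (false ∷ _) (false ∷ _) (false ∷ _) (false ∷ _) refl refl refl refl = refl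

record Quadruple {k d : ℕ} (S : Fin k → Subset d) (L : List (Fin k)) (j : ℕ) : Set where
  constructor quadruple
  field
    α β γ δ : Fin k
    α∈L : α ∈ L
    β∈L : β ∈ L
    γ∈L : γ ∈ L
    δ∈L : δ ∈ L
    α≢β : α ≢ β
    α≢γ : α ≢ γ
    α≢δ : α ≢ δ
    β≢γ : β ≢ γ
    β≢δ : β ≢ δ
    γ≢δ : γ ≢ δ
    j≤tet : j ≤ tet (S α) (S β) (S γ) (S δ)

module _ {k d : ℕ} (S : Fin k → Subset (suc d)) where

  firstCoordinate : Fin k → Bool
  firstCoordinate α = head (S α)

  Quadruple-lift : ∀ b {j} L → Quadruple (λ α → tail (S α)) (fibre firstCoordinate b L) j → Quadruple S L (suc j)
  Quadruple-lift b L (quadruple α β γ δ α∈ β∈ γ∈ δ∈ α≢β α≢γ α≢δ β≢γ β≢δ γ≢δ j≤tet)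
    with α∈L , α↦b ← ∈-fibre⁻ firstCoordinate α∈
       | β∈L , β↦b ← ∈-fibre⁻ firstCoordinate β∈
       | γ∈L , γ↦b ← ∈-fibre⁻ firstCoordinate γ∈
       | δ∈L , δ↦b ← ∈-fibre⁻ firstCoordinate δ∈
    = quadruple α β γ δ α∈L β∈L γ∈L δ∈L α≢β α≢γ α≢δ β≢γ β≢δ γ≢δ
        (subst (_ ≤_) (sym (tet-common-head b (S α) (S β) (S γ) (S δ) α↦b β↦b γ↦b δ↦b)) (s≤s j≤tet))

3*2^[1+n]≡3*2^n+3*2^n : ∀ n → 3 * 2 ^ suc n ≡ 3 * 2 ^ n + 3 * 2 ^ n
3*2^[1+n]≡3*2^n+3*2^n n = doubling (2 ^ n)
  where
  doubling : ∀ m → 3 * (2 * m) ≡ 3 * m + 3 * m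
  doubling = solve-∀

quadruple-of-list : ∀ j {k d} (S : Fin k → Subset d) (L : List (Fin k)) →
  Unique L → j ≤ d → 3 * 2 ^ j < length L → Quadruple S L j
quadruple-of-list zero S (α ∷ β ∷ γ ∷ δ ∷ _) ((α≢β ∷ α≢γ ∷ α≢δ ∷ _) ∷ (β≢γ ∷ β≢δ ∷ _) ∷ (γ≢δ ∷ _) ∷ _) _ _ =
  quadruple α β γ δ (here refl) (there (here refl)) (there (there (here refl))) (there (there (there (here refl))))
    α≢β α≢γ α≢δ β≢γ β≢δ γ≢δ z≤n
quadruple-of-list zero S (_ ∷ _ ∷ _ ∷ []) _ _ (s≤s (s≤s (s≤s ())))
quadruple-of-list zero S (_ ∷ _ ∷ [])     _ _ (s≤s (s≤s ()))
quadruple-of-list zero S (_ ∷ [])         _ _ (s≤s ())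
quadruple-of-list zero S []               _ _ ()
quadruple-of-list (suc j) {d = suc d} S L unique (s≤s j≤d) large
  with m+m<n+o⇒m<n⊎m<o _ _ _ (subst₂ _<_ (3*2^[1+n]≡3*2^n+3*2^n j) (sym (length-fibres (firstCoordinate S) L)) large)
... | inj₁ large-true  = Quadruple-lift S true L (quadruple-of-list j _ _ (filter⁺ _ unique) j≤d large-true)
... | inj₂ large-false = Quadruple-lift S false L (quadruple-of-list j _ _ (filter⁺ _ unique) j≤d large-false)

quadruple-of-family : ∀ j {k d} (S : Fin k → Subset d) → j ≤ d → 3 * 2 ^ j < k → Quadruple S (allFin k) j
quadruple-of-family j {k} S j≤d large =
  quadruple-of-list j S (allFin k) (allFin⁺ k) j≤d (subst (3 * 2 ^ j <_) (sym (length-tabulate (λ α → α))) large)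

boundPolynomial : ℕ → ℕ → ℤ
boundPolynomial d k = (+ k) *ℤ (+ k) *ℤ ((+ 28) -ℤ (+ 3) *ℤ (+ d)) -ℤ (+ 56) *ℤ (+ k) +ℤ (+ 15) *ℤ (+ d)

Conclusion : ℕ → ℕ → Set
Conclusion d k = (boundPolynomial d k ≤ℤ + 0) × (d ≡ 7 → k ≤ 5) × (d ≡ 8 → k ≤ 11)

OddConclusion : ℕ → ℕ → Set
OddConclusion d k = 3 < k → ¬ 2 ∣ k → Conclusion d k

OddConclusion? : ∀ d k → Dec (OddConclusion d k)
OddConclusion? d k =
  3 <? k →-dec ¬? (2 ∣? k) →-dec (boundPolynomial d k ℤ.≤? + 0) ×-dec (d ≟ 7 →-dec k ≤? 5) ×-dec (d ≟ 8 →-dec k ≤? 11)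

excess : ℕ → ℕ → ℕ
excess e a = 106 + a * (72 + 2 * a) + e * (33 + a * (24 + 3 * a))

excess-ℤ : ℤ → ℤ → ℤ
excess-ℤ E A = + 106 +ℤ A *ℤ (+ 72 +ℤ + 2 *ℤ A) +ℤ E *ℤ (+ 33 +ℤ A *ℤ (+ 24 +ℤ + 3 *ℤ A))

+excess≡excess-ℤ : ∀ e a → + excess e a ≡ excess-ℤ (+ e) (+ a)
+excess≡excess-ℤ e a = cong₂ (λ X Y → + 106 +ℤ X +ℤ Y) a[72+2a] e[33+a[24+3a]]
  where
  a[72+2a] : + (a * (72 + 2 * a)) ≡ + a *ℤ (+ 72 +ℤ + 2 *ℤ + a)
  a[72+2a] = trans (ℤ.pos-* a _) (cong (λ X → + a *ℤ (+ 72 +ℤ X)) (ℤ.pos-* 2 a))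
  a[24+3a] : + (a * (24 + 3 * a)) ≡ + a *ℤ (+ 24 +ℤ + 3 *ℤ + a)
  a[24+3a] = trans (ℤ.pos-* a _) (cong (λ X → + a *ℤ (+ 24 +ℤ X)) (ℤ.pos-* 3 a))
  e[33+a[24+3a]] : + (e * (33 + a * (24 + 3 * a))) ≡ + e *ℤ (+ 33 +ℤ + a *ℤ (+ 24 +ℤ + 3 *ℤ + a))
  e[33+a[24+3a]] = trans (ℤ.pos-* e _) (cong (λ X → + e *ℤ (+ 33 +ℤ X)) a[24+3a])

boundPolynomial-large : ∀ e a → boundPolynomial (10 + e) (4 + a) ≡ -ℤ + excess e a
boundPolynomial-large e a = begin
  boundPolynomial (10 + e) (4 + a) ≡⟨ expand (+ e) (+ a) ⟩
  -ℤ excess-ℤ (+ e) (+ a)          ≡⟨ cong -ℤ_ (+excess≡excess-ℤ e a) ⟨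
  -ℤ + excess e a                  ∎
  where
  open ≡-Reasoning
  expand : ∀ E A →
    (+ 4 +ℤ A) *ℤ (+ 4 +ℤ A) *ℤ (+ 28 -ℤ + 3 *ℤ (+ 10 +ℤ E)) -ℤ + 56 *ℤ (+ 4 +ℤ A) +ℤ + 15 *ℤ (+ 10 +ℤ E)
      ≡ -ℤ (+ 106 +ℤ A *ℤ (+ 72 +ℤ + 2 *ℤ A) +ℤ E *ℤ (+ 33 +ℤ A *ℤ (+ 24 +ℤ + 3 *ℤ A)))
  expand = ℤ-solve-∀

conclusion-large : ∀ e {k} → 3 < k → Conclusion (10 + e) k
conclusion-large e {suc (suc (suc (suc a)))} (s≤s (s≤s (s≤s (s≤s _)))) =
  subst (_≤ℤ + 0) (sym (boundPolynomial-large e a)) ℤ.neg-≤-pos , (λ ()) , (λ ())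

conclusion-of-bounds : ∀ d k → 7 ≤ d → 3 < k → ¬ 2 ∣ k → k ≤ 3 * 2 ^ (d ∸ 6) → Conclusion d k
conclusion-of-bounds d k 7≤d k>3 odd k≤ with m≤n⇒∃[o]m+o≡n 7≤d
... | 0 , refl = from-yes (allUpTo? (OddConclusion? 7) 7) (s≤s k≤) k>3 odd
... | 1 , refl = from-yes (allUpTo? (OddConclusion? 8) 13) (s≤s k≤) k>3 odd
... | 2 , refl = from-yes (allUpTo? (OddConclusion? 9) 25) (s≤s k≤) k>3 odd
... | suc (suc (suc e)) , refl = conclusion-large e k>3

size-bound : ∀ {d k} → (∀ j → j ≤ d → 3 * 2 ^ j < k → j + 7 ≤ d) → 6 ≤ d → k ≤ 3 * 2 ^ (d ∸ 6)
size-bound {d} quadruple-bound 6≤d =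
  ≮⇒≥ λ large → <-irrefl refl (subst (_≤ d) j+7≡1+d (quadruple-bound j (m∸n≤m d 6) large))
  where
  j : ℕ
  j = d ∸ 6
  j+7≡1+d : j + 7 ≡ suc d
  j+7≡1+d = trans (+-suc j 6) (cong suc (m∸n+n≡m 6≤d))

mainTheorem3 : (d k : ℕ) → 1 ≤ d → 3 < k → ¬ (2 ∣ k)
    → (S : Fin k → Subset d)
    → (∀ α β → S α ≡ S β → α ≡ β)
    → (∀ α → 2 ∣ ∣ S α ∣)
    → (∀ α β → α ≢ β → 4 ≤ ∣ S α △ S β ∣)
    → (∀ α β γ δ → α ≢ β → α ≢ γ → α ≢ δ → β ≢ γ → β ≢ δ → γ ≢ δ
         → tet (S α) (S β) (S γ) (S δ) + 7 ≤ d)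
    → ((+ k) *ℤ (+ k) *ℤ ((+ 28) -ℤ (+ 3) *ℤ (+ d)) -ℤ (+ 56) *ℤ (+ k) +ℤ (+ 15) *ℤ (+ d) ≤ℤ + 0)
      × (d ≡ 7 → k ≤ 5) × (d ≡ 8 → k ≤ 11)
mainTheorem3 d k _ k>3 odd S _ _ _ tet+7≤d =
  conclusion-of-bounds d k 7≤d k>3 odd (size-bound quadruple-bound (<⇒≤ 7≤d))
  where
  quadruple-bound : ∀ j → j ≤ d → 3 * 2 ^ j < k → j + 7 ≤ d
  quadruple-bound j j≤d large = ≤-trans (+-monoˡ-≤ 7 j≤tet) (tet+7≤d α β γ δ α≢β α≢γ α≢δ β≢γ β≢δ γ≢δ)
    where open Quadruple (quadruple-of-family j S j≤d large)
  7≤d : 7 ≤ d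
  7≤d = quadruple-bound 0 z≤n k>3
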